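{- Let $p$ be a prime number and $n\in\mathbb{N}$, $n\ge 1$. Then there exists a bijection between the set $W_p^n$ and the orbit set $(\mathbb{Z}_p\times\mathbb{Z}_p)^n/\mathrm{SL}(2,\mathbb{Z})$.
   Context: Consider the alphabet of $p^2$ letters $\{0,1,\dots,p^2-1\}$. $W_p^n$ is the set of words $a_1a_2\dots a_n$ of length $n$ over this alphabet such that there exist indices $1\le j<k$, with $j\le n+1$, satisfying (conditions referring to positions larger than $n$ are vacuous): (R1) $a_i=0$ for all $i<j$; (R2) $a_j=1$ if $j\le n$; (R3) $a_i\in\{0,1,\dots,p-1\}$ for $j<i<k$, $i\le n$; (R4) $a_k\in\{p,2p,\dots,(p-1)p\}$ if $k\le n$; (R5) $a_i\in\{0,1,\dots,p^2-1\}$ for $k<i\le n$. (Taking $j=n+1$ means the all-zero word belongs to $W_p^n$.) The group $\mathrm{SL}(2,\mathbb{Z})$ acts on the left on $(\mathbb{Z}_p\times\mathbb{Z}_p)^n$, whose elements are viewed as $2\times n$ matrices $\binom{u}{v}$ with rows $u,v\in\mathbb{Z}_p^n$, by matrix multiplication $S\binom{u}{v}$ with the entries of $S$ reduced modulo $p$; $(\mathbb{Z}_p\times\mathbb{Z}_p)^n/\mathrm{SL}(2,\mathbb{Z})$ denotes the set of orbits of this action. -}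

module Defs where

open import Data.Nat as ℕ using (ℕ; zero; suc; _<_; _≤_)
open import Data.Integer as ℤ using (ℤ; +_)
open import Data.Integer.Divisibility using () renaming (_∣_ to _∣ℤ_)
open import Data.Fin using (Fin; toℕ)
open import Data.Product using (Σ; _×_; _,_; ∃; ∃-syntax)
open import Relation.Binary.PropositionalEquality using (_≡_)

-- A word of length n over the alphabet {0,…,p²-1}; letter a_i (1 ≤ i ≤ n) is w (i-1).
Word : ℕ → ℕ → Set
Word p n = Fin n → Fin (p ℕ.* p)

pos : {n : ℕ} → Fin n → ℕ
pos i = suc (toℕ i)

IsMultLetter : (p : ℕ) → ℕ → Set
IsMultLetter p a = ∃[ t ] (1 ≤ t × t < p × a ≡ t ℕ.* p)

-- Conditions (R1)–(R5) for given indices j < k (conditions at positions > n vacuous).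
Conds : (p n : ℕ) → Word p n → ℕ → ℕ → Set
Conds p n w j k =
    (∀ (i : Fin n) → pos i < j → toℕ (w i) ≡ 0)
  × (∀ (i : Fin n) → pos i ≡ j → toℕ (w i) ≡ 1)
  × (∀ (i : Fin n) → j < pos i → pos i < k → toℕ (w i) < p)
  × (∀ (i : Fin n) → pos i ≡ k → IsMultLetter p (toℕ (w i)))
  -- R5 (a_i ∈ {0,…,p²-1} for k < i ≤ n) holds automatically for letters.

InW : (p n : ℕ) → Word p n → Set
InW p n w = ∃[ j ] ∃[ k ] (1 ≤ j × j < k × j ≤ suc n × Conds p n w j k)

-- Elements of (ℤ_p × ℤ_p)^n as 2×n matrices with rows u, v ∈ ℤ_p^n
Config : ℕ → ℕ → Set
Config p n = (Fin n → Fin p) × (Fin n → Fin p)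

record SL2Z : Set where
  field
    a b c d : ℤ
    det : a ℤ.* d ℤ.- b ℤ.* c ≡ ℤ.+ 1

toℤ : {p : ℕ} → Fin p → ℤ
toℤ x = + toℕ x

_≡[mod_]_ : ℤ → ℕ → ℤ → Set
x ≡[mod p ] y = (+ p) ∣ℤ (x ℤ.- y)

Acts : {p n : ℕ} → SL2Z → Config p n → Config p n → Set
Acts {p} {n} S (u , v) (u' , v') =
  ∀ (i : Fin n) →
      (a ℤ.* toℤ (u i) ℤ.+ b ℤ.* toℤ (v i)) ≡[mod p ] toℤ (u' i)
    × (c ℤ.* toℤ (u i) ℤ.+ d ℤ.* toℤ (v i)) ≡[mod p ] toℤ (v' i)
  where open SL2Z S

SameOrbit : {p n : ℕ} → Config p n → Config p n → Set
SameOrbit x y = ∃[ S ] Acts S x y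

_≈W_ : {m n : ℕ} → (Fin n → Fin m) → (Fin n → Fin m) → Set
w ≈W w' = ∀ i → w i ≡ w' i

-- A bijection W_p^n ≅ (ℤ_p×ℤ_p)^n / SL(2,ℤ), presented (no quotient types) as a map
-- g from configurations into W_p^n that is well defined and injective on orbits
-- (g x = g y ⇔ same orbit) and surjective onto W_p^n.
OrbitBijection : (p n : ℕ) → Set
OrbitBijection p n =
  Σ (Config p n → Word p n) λ g →
      (∀ x → InW p n (g x))
    × (∀ x y → SameOrbit x y → g x ≈W g y)
    × (∀ x y → g x ≈W g y → SameOrbit x y)
    × (∀ w → InW p n w → ∃[ x ] (g x ≈W w))

module Submission where

-- Encode the column (u, v) of a configuration as the letter p·v + u.  Then (R1)–(R4) say exactly
-- that the configuration is canonical: its first nonzero column is (1, 0), the columns after it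
-- have v = 0 up to a pivot column (0, v) with v ≠ 0, and everything after the pivot is arbitrary.
-- Every SL(2,ℤ)-orbit contains a canonical configuration: SL(2, ℤ/p) acts transitively on nonzero
-- vectors, so the first nonzero column can be sent to (1, 0), and then a shear (1 t; 0 1), which
-- fixes every column with v = 0, clears u in the pivot column.  It contains only one: a matrix
-- taking a canonical configuration to another one fixes (1, 0) mod p, so it is a shear mod p; a
-- shear leaves the v-row unchanged, hence the pivots agree, and clearing u there forces t ≡ 0.

open import Defs
open import Data.Empty using (⊥-elim)
open import Data.Fin as Fin using (Fin; zero; suc; toℕ; fromℕ<)
import Data.Fin.Properties as Fin
open import Data.Integer as ℤ using (ℤ; +_; _+_; _*_; -_; _-_)
open import Data.Integer.Divisibility.Signed
  using (_∣_; ∣⇒∣ᵤ; ∣ᵤ⇒∣; divides; ∣m∣n⇒∣m+n; ∣m⇒∣-m; ∣m⇒∣m*n; ∣n⇒∣m*n)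
open import Data.Integer.DivMod using (_%ℕ_; _/ℕ_; n%ℕd<d; a≡a%ℕn+[a/ℕn]*n)
import Data.Integer.Properties as ℤ
open import Data.Integer.Tactic.RingSolver using (solve; solve-∀)
open import Data.List using (_∷_; [])
open import Data.Nat as ℕ using (ℕ; z≤n; s≤s; _≤_; _<_; NonZero)
open import Data.Nat.Coprimality using (prime⇒coprime; coprime-Bézout)
import Data.Nat.Divisibility as ℕ using (_∣_; ∣⇒≤)
open import Data.Nat.GCD using (module Bézout)
open import Data.Nat.Primality using (Prime; prime⇒nonTrivial)
import Data.Nat.Properties as ℕ
open import Data.Product using (_×_; _,_; proj₁; proj₂; ∃-syntax)
open import Data.Product.Properties using (≡-dec)
open import Data.Sum using (inj₁; inj₂)
open import Function using (_∘_; _∋_)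
open import Function.Bundles using (_⇔_; mk⇔; Equivalence)
open import Level using (0ℓ)
open import Relation.Binary.Bundles using (Setoid)
open import Relation.Binary.Definitions using (DecidableEquality; tri<; tri≈; tri>)
open import Relation.Binary.PropositionalEquality
import Relation.Binary.Reasoning.Setoid
open import Relation.Nullary using (¬_; yes; no; ¬?)
open import Relation.Nullary.Decidable using (decidable-stable)
open import Relation.Unary using (Decidable)

position : ∀ {n k} → 1 ≤ k → k ≤ n → ∃[ i ] pos {n} i ≡ k
position {k = ℕ.suc m} _ m<n = fromℕ< m<n , cong ℕ.suc (Fin.toℕ-fromℕ< m<n)

pos-injective : ∀ {n} {i i′ : Fin n} → pos i ≡ pos i′ → i ≡ i′
pos-injective = Fin.toℕ-injective ∘ ℕ.suc-injective

least-≤ : ∀ {n k₁ k₂} {P : Fin n → Set} → (∀ i → pos i < k₁ → ¬ P i) → (∀ i → pos i ≡ k₂ → P i) →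
          1 ≤ k₂ → k₂ ≤ n → k₁ ≤ k₂
least-≤ before at 1≤k₂ k₂≤n with position 1≤k₂ k₂≤n
... | i , refl = ℕ.≮⇒≥ λ pos<k₁ → before i pos<k₁ (at i refl)

-- The least position at which P holds, or n + 1 if there is none.
record First {n} (P : Fin n → Set) : Set where
  field
    index : ℕ
    1≤index : 1 ≤ index
    before : ∀ i → pos i < index → ¬ P i
    at : ∀ i → pos i ≡ index → P i

first : ∀ {n} {P : Fin n → Set} → Decidable P → First P
first {ℕ.zero} _ = record { index = 1 ; 1≤index = ℕ.≤-refl ; before = λ () ; at = λ () }
first {ℕ.suc n} P? with P? zero
... | yes P₀ = record
  { index = 1 ; 1≤index = ℕ.≤-refl
  ; before = λ _ → λ { (s≤s ()) }
  ; at = λ { zero _ → P₀ ; (suc _) () }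
  }
... | no ¬P₀ = record
  { index = ℕ.suc index ; 1≤index = s≤s z≤n
  ; before = λ { zero _ → ¬P₀ ; (suc i) (s≤s pos<index) → before i pos<index }
  ; at = λ { zero 1≡1+index → ⊥-elim (ℕ.<⇒≢ 1≤index (ℕ.suc-injective 1≡1+index))
           ; (suc i) pos≡index → at i (ℕ.suc-injective pos≡index) }
  }
  where open First (first (P? ∘ suc))

infixl 7 _·_
_·_ : SL2Z → SL2Z → SL2Z
record { a = a ; b = b ; c = c ; d = d ; det = det } · record { a = a′ ; b = b′ ; c = c′ ; d = d′ ; det = det′ } =
  record
    { a = a * a′ + b * c′ ; b = a * b′ + b * d′
    ; c = c * a′ + d * c′ ; d = c * b′ + d * d′
    ; det = begin
        (a * a′ + b * c′) * (c * b′ + d * d′) - (a * b′ + b * d′) * (c * a′ + d * c′)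
          ≡⟨ solve (a ∷ b ∷ c ∷ d ∷ a′ ∷ b′ ∷ c′ ∷ d′ ∷ []) ⟩
        (a * d - b * c) * (a′ * d′ - b′ * c′)  ≡⟨ cong₂ _*_ det det′ ⟩
        + 1                                     ∎ }
  where open ≡-Reasoning

infix 8 _⁻¹
_⁻¹ : SL2Z → SL2Z
record { a = a ; b = b ; c = c ; d = d ; det = det } ⁻¹ =
  record { a = d ; b = - b ; c = - c ; d = a
         ; det = trans (d * a - - b * - c ≡ a * d - b * c ∋ solve (a ∷ b ∷ c ∷ d ∷ [])) det }

upper : ℤ → SL2Z
upper t = record { a = + 1 ; b = t ; c = + 0 ; d = + 1 ; det = solve (t ∷ []) }

lower : ℤ → SL2Z
lower t = record { a = + 1 ; b = + 0 ; c = t ; d = + 1 ; det = solve (t ∷ []) }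

multiple<⇒≡0 : ∀ {m d} → m ℕ.∣ d → d < m → d ≡ 0
multiple<⇒≡0 {d = ℕ.zero}  _   _   = refl
multiple<⇒≡0 {d = ℕ.suc d} m∣d d<m = ⊥-elim (ℕ.<⇒≱ d<m (ℕ.∣⇒≤ m∣d))

module Modulo (m : ℕ) where

  -- A record rather than _≡[mod_]_ itself, so that x and y can be inferred from x ≈ y.
  infix 4 _≈_
  record _≈_ (x y : ℤ) : Set where
    constructor ⟨_⟩
    field get : x ≡[mod m ] y
  open _≈_ public

  ≈-fromDiff : ∀ {x y z} → x - y ≡ z → + m ∣ z → x ≈ y
  ≈-fromDiff refl m∣z = ⟨ ∣⇒∣ᵤ m∣z ⟩

  diff : ∀ {x y} → x ≈ y → + m ∣ x - y
  diff ⟨ h ⟩ = ∣ᵤ⇒∣ h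

  ≈-reflexive : ∀ {x y} → x ≡ y → x ≈ y
  ≈-reflexive {x} refl = ≈-fromDiff (ℤ.+-inverseʳ x) (divides (+ 0) refl)

  ≈-refl : ∀ {x} → x ≈ x
  ≈-refl = ≈-reflexive refl

  ≈-sym : ∀ {x y} → x ≈ y → y ≈ x
  ≈-sym {x} {y} h = ≈-fromDiff {z = - (x - y)} (solve (x ∷ y ∷ [])) (∣m⇒∣-m (diff h))

  ≈-trans : ∀ {x y z} → x ≈ y → y ≈ z → x ≈ z
  ≈-trans {x} {y} {z} h k =
    ≈-fromDiff {z = (x - y) + (y - z)} (solve (x ∷ y ∷ z ∷ [])) (∣m∣n⇒∣m+n (diff h) (diff k))

  ≈-setoid : Setoid 0ℓ 0ℓ
  ≈-setoid = record
    { Carrier = ℤ ; _≈_ = _≈_ ; isEquivalence = record { refl = ≈-refl ; sym = ≈-sym ; trans = ≈-trans } }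

  module ≈-Reasoning = Relation.Binary.Reasoning.Setoid ≈-setoid

  +-cong : ∀ {x y u v} → x ≈ y → u ≈ v → x + u ≈ y + v
  +-cong {x} {y} {u} {v} h k =
    ≈-fromDiff {z = (x - y) + (u - v)} (solve (x ∷ y ∷ u ∷ v ∷ [])) (∣m∣n⇒∣m+n (diff h) (diff k))

  *-cong : ∀ {x y u v} → x ≈ y → u ≈ v → x * u ≈ y * v
  *-cong {x} {y} {u} {v} h k =
    ≈-fromDiff {z = (x - y) * u + y * (u - v)} (solve (x ∷ y ∷ u ∷ v ∷ []))
      (∣m∣n⇒∣m+n (∣m⇒∣m*n u (diff h)) (∣n⇒∣m*n y (diff k)))

  neg-cong : ∀ {x y} → x ≈ y → - x ≈ - y
  neg-cong {x} {y} h = ≈-fromDiff {z = - (x - y)} (solve (x ∷ y ∷ [])) (∣m⇒∣-m (diff h))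

  -cong : ∀ {x y u v} → x ≈ y → u ≈ v → x - u ≈ y - v
  -cong h k = +-cong h (neg-cong k)

  +-congˡ : ∀ k {u v} → u ≈ v → k + u ≈ k + v
  +-congˡ k = +-cong (≈-refl {k})

  *-congˡ : ∀ k {u v} → u ≈ v → k * u ≈ k * v
  *-congˡ k = *-cong (≈-refl {k})

  x+y≈x : ∀ {x y} → y ≈ + 0 → x + y ≈ x
  x+y≈x {x} y≈0 = ≈-trans (+-congˡ x y≈0) (≈-reflexive (ℤ.+-identityʳ x))

  cancel-invertible : ∀ {r b} w → w * r ≈ + 1 → b * r ≈ + 0 → b ≈ + 0
  cancel-invertible {r} {b} w wr≈1 br≈0 = begin
    b               ≡⟨ solve (b ∷ []) ⟩
    b * + 1         ≈⟨ *-congˡ b (≈-sym wr≈1) ⟩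
    b * (w * r)     ≡⟨ solve (b ∷ w ∷ r ∷ []) ⟩
    w * (b * r)     ≈⟨ *-congˡ w br≈0 ⟩
    w * + 0         ≡⟨ solve (w ∷ []) ⟩
    + 0             ∎
    where open ≈-Reasoning

  toℤ-≈-injective : {x y : Fin m} → toℤ x ≈ toℤ y → x ≡ y
  toℤ-≈-injective {x} {y} ⟨ m∣x-y ⟩ =
    Fin.toℕ-injective (ℤ.+-injective (ℤ.i-j≡0⇒i≡j _ _ (ℤ.∣i∣≡0⇒i≡0 (multiple<⇒≡0 m∣x-y ∣x-y∣<m))))
    where
    ∣x-y∣<m : ℤ.∣ toℤ x - toℤ y ∣ < m
    ∣x-y∣<m rewrite ℤ.m-n≡m⊖n (toℕ x) (toℕ y) =
      ℕ.≤-<-trans (ℤ.∣m⊝n∣≤m⊔n (toℕ x) (toℕ y)) (ℕ.⊔-lub (Fin.toℕ<n x) (Fin.toℕ<n y))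

  module _ {{_ : NonZero m}} where

    reduce : ℤ → Fin m
    reduce z = fromℕ< (n%ℕd<d z m)

    reduce-≈ : ∀ z → toℤ (reduce z) ≈ z
    reduce-≈ z = ≈-sym (≈-fromDiff z-r≡qm (divides (z /ℕ m) refl))
      where
      open ≡-Reasoning
      [r+k]-r≡k : ∀ r k → (r + k) - r ≡ k
      [r+k]-r≡k = solve-∀
      r : ℤ
      r = + (z %ℕ m)
      z-r≡qm : z - toℤ (reduce z) ≡ (z /ℕ m) * + m
      z-r≡qm = begin
        z - toℤ (reduce z)         ≡⟨ cong₂ _-_ (a≡a%ℕn+[a/ℕn]*n z m) (cong +_ (Fin.toℕ-fromℕ< _)) ⟩
        (r + (z /ℕ m) * + m) - r  ≡⟨ [r+k]-r≡k r ((z /ℕ m) * + m) ⟩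
        (z /ℕ m) * + m             ∎

  Sends : SL2Z → ℤ × ℤ → ℤ × ℤ → Set
  Sends S (x , y) (x′ , y′) = (a * x + b * y ≈ x′) × (c * x + d * y ≈ y′)
    where open SL2Z S

  sends-· : ∀ {S T u v w} → Sends S u v → Sends T v w → Sends (T · S) u w
  sends-· {record { a = a ; b = b ; c = c ; d = d }} {record { a = a′ ; b = b′ ; c = c′ ; d = d′ }} {x , y} {v}
          (h₁ , h₂) (k₁ , k₂) = row a′ b′ k₁ , row c′ d′ k₂
    where
    row : ∀ s t {z} → s * proj₁ v + t * proj₂ v ≈ z → (s * a + t * c) * x + (s * b + t * d) * y ≈ z
    row s t k = ≈-trans {y = s * (a * x + b * y) + t * (c * x + d * y)}
      (≈-reflexive (solve (s ∷ t ∷ a ∷ b ∷ c ∷ d ∷ x ∷ y ∷ [])))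
      (≈-trans (+-cong (*-congˡ s h₁) (*-congˡ t h₂)) k)

  sends-⁻¹ : ∀ {S u v} → Sends S u v → Sends (S ⁻¹) v u
  sends-⁻¹ {record { a = a ; b = b ; c = c ; d = d ; det = det }} {x , y} {x′ , y′} (h₁ , h₂) =
    row d (- b) x (solve (a ∷ b ∷ c ∷ d ∷ x ∷ y ∷ [])) ,
    row (- c) a y (solve (a ∷ b ∷ c ∷ d ∷ x ∷ y ∷ []))
    where
    row : ∀ s t z → s * (a * x + b * y) + t * (c * x + d * y) ≡ (a * d - b * c) * z → s * x′ + t * y′ ≈ z
    row s t z e = ≈-trans (+-cong (*-congˡ s (≈-sym h₁)) (*-congˡ t (≈-sym h₂)))
                          (≈-reflexive (trans e (trans (cong (_* z) det) (ℤ.*-identityˡ z))))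

  fixes-e₁⇒shear : ∀ {S x y x′ y′} → Sends S (+ 1 , + 0) (+ 1 , + 0) → Sends S (x , y) (x′ , y′) →
                   (x′ ≈ x + SL2Z.b S * y) × (y′ ≈ y)
  fixes-e₁⇒shear {record { a = a ; b = b ; c = c ; d = d ; det = det }} {x} {y} {x′} {y′}
                 (e₁ , e₂) (h₁ , h₂) = x′≈x+by , y′≈y
    where
    open ≈-Reasoning
    a≈1 : a ≈ + 1
    a≈1 = begin a ≡⟨ solve (a ∷ b ∷ []) ⟩ a * + 1 + b * + 0 ≈⟨ e₁ ⟩ + 1 ∎
    c≈0 : c ≈ + 0
    c≈0 = begin c ≡⟨ solve (c ∷ d ∷ []) ⟩ c * + 1 + d * + 0 ≈⟨ e₂ ⟩ + 0 ∎
    d≈1 : d ≈ + 1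
    d≈1 = begin
      d                   ≡⟨ solve (b ∷ d ∷ []) ⟩
      + 1 * d - b * + 0   ≈⟨ -cong (*-cong (≈-sym a≈1) ≈-refl) (*-congˡ b (≈-sym c≈0)) ⟩
      a * d - b * c       ≡⟨ det ⟩
      + 1                 ∎
    x′≈x+by : x′ ≈ x + b * y
    x′≈x+by = begin
      x′               ≈⟨ ≈-sym h₁ ⟩
      a * x + b * y    ≈⟨ +-cong (*-cong a≈1 ≈-refl) ≈-refl ⟩
      + 1 * x + b * y  ≡⟨ cong (_+ b * y) (ℤ.*-identityˡ x) ⟩
      x + b * y        ∎
    y′≈y : y′ ≈ y
    y′≈y = begin
      y′                  ≈⟨ ≈-sym h₂ ⟩
      c * x + d * y       ≈⟨ +-cong (*-cong c≈0 ≈-refl) (*-cong d≈1 ≈-refl) ⟩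
      + 0 * x + + 1 * y   ≡⟨ solve (x ∷ y ∷ []) ⟩
      y                   ∎

  upper-fixes-e₁ : ∀ {t} → Sends (upper t) (+ 1 , + 0) (+ 1 , + 0)
  upper-fixes-e₁ {t} = ≈-reflexive (+ 1 * + 1 + t * + 0 ≡ + 1 ∋ solve (t ∷ [])) , ≈-refl

  lower-sends : ∀ {x w} → Sends (lower w) (x , + 0) (x , w * x)
  lower-sends {x} {w} =
    ≈-reflexive (solve (x ∷ [])) , ≈-reflexive (w * x + + 1 * + 0 ≡ w * x ∋ solve (x ∷ w ∷ []))

  shear-kills : ∀ {x y} w → w * y ≈ + 1 → x + - (x * w) * y ≈ + 0
  shear-kills {x} {y} w wy≈1 = begin
    x + - (x * w) * y    ≡⟨ solve (x ∷ w ∷ y ∷ []) ⟩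
    x - x * (w * y)      ≈⟨ -cong (≈-refl {x}) (*-congˡ x wy≈1) ⟩
    x - x * + 1          ≡⟨ solve (x ∷ []) ⟩
    + 0                  ∎
    where open ≈-Reasoning

  sends-to-e₁ : ∀ {x y} w → w * y ≈ + 1 → ∃[ S ] Sends S (x , y) (+ 1 , + 0)
  sends-to-e₁ {x} {y} w wy≈1 = lower (- y) · upper t , sends-· {upper t} {lower (- y)} to-[1,y] to-[1,0]
    where
    open ≈-Reasoning
    t : ℤ
    t = (+ 1 - x) * w
    to-[1,y] : Sends (upper t) (x , y) (+ 1 , y)
    to-[1,y] = (begin
      + 1 * x + (+ 1 - x) * w * y     ≡⟨ solve (x ∷ y ∷ w ∷ []) ⟩
      x + (+ 1 - x) * (w * y)         ≈⟨ +-congˡ x (*-congˡ (+ 1 - x) wy≈1) ⟩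
      x + (+ 1 - x) * + 1             ≡⟨ solve (x ∷ []) ⟩
      + 1                             ∎) ,
      ≈-reflexive (solve (x ∷ y ∷ []))
    to-[1,0] : Sends (lower (- y)) (+ 1 , y) (+ 1 , + 0)
    to-[1,0] = ≈-reflexive (solve (y ∷ [])) , ≈-reflexive (- y * + 1 + + 1 * y ≡ + 0 ∋ solve (y ∷ []))

a+b*c≡d*e⇒ℤ : ∀ {a b c d e} → a ℕ.+ b ℕ.* c ≡ d ℕ.* e → + a + + b * + c ≡ + d * + e
a+b*c≡d*e⇒ℤ {a} {b} {c} {d} {e} eq = begin
  + a + + b * + c     ≡⟨ cong (_+_ (+ a)) (ℤ.pos-* b c) ⟨
  + a + + (b ℕ.* c)   ≡⟨ ℤ.pos-+ a (b ℕ.* c) ⟨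
  + (a ℕ.+ b ℕ.* c)   ≡⟨ cong +_ eq ⟩
  + (d ℕ.* e)         ≡⟨ ℤ.pos-* d e ⟩
  + d * + e           ∎
  where open ≡-Reasoning

module Orbits (q : ℕ) (isPrime : Prime (2 ℕ.+ q)) where

  p : ℕ
  p = 2 ℕ.+ q

  open Modulo p

  invertible : (r : Fin p) → r ≢ zero → ∃[ w ] w * toℤ r ≈ + 1
  invertible zero r≢0 = ⊥-elim (r≢0 refl)
  invertible r@(suc _) _ with coprime-Bézout (prime⇒coprime isPrime (Fin.toℕ<n r))
  ... | Bézout.+- x y eq =
    - + y , ≈-fromDiff {z = - (+ x * + p)}
              (trans (regroup (+ y) (toℤ r)) (cong -_ (a+b*c≡d*e⇒ℤ {1} {y} {toℕ r} {x} {p} eq)))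
              (∣m⇒∣-m (divides (+ x) refl))
    where
    regroup : ∀ y r → - y * r - + 1 ≡ - (+ 1 + y * r)
    regroup = solve-∀
  ... | Bézout.-+ x y eq =
    + y , ≈-fromDiff {z = + x * + p}
            (trans (cong (_- + 1) (sym (a+b*c≡d*e⇒ℤ {1} {x} {p} {y} {toℕ r} eq))) (regroup (+ x) (+ p)))
            (divides (+ x) refl)
    where
    regroup : ∀ x p → (+ 1 + x * p) - + 1 ≡ x * p
    regroup = solve-∀

  Column : Set
  Column = Fin p × Fin p

  𝟎 e₁ : Column
  𝟎 = zero , zero
  e₁ = suc zero , zero

  _≟ᶜ_ : DecidableEquality Column
  _≟ᶜ_ = ≡-dec Fin._≟_ Fin._≟_

  ⟦_⟧ : Column → ℤ × ℤ
  ⟦ c ⟧ = toℤ (proj₁ c) , toℤ (proj₂ c)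

  sends-functional : ∀ {S u c c′} → Sends S u ⟦ c ⟧ → Sends S u ⟦ c′ ⟧ → c ≡ c′
  sends-functional (h₁ , h₂) (k₁ , k₂) =
    cong₂ _,_ (toℤ-≈-injective (≈-trans (≈-sym h₁) k₁)) (toℤ-≈-injective (≈-trans (≈-sym h₂) k₂))

  sends-𝟎 : ∀ {S} → Sends S ⟦ 𝟎 ⟧ ⟦ 𝟎 ⟧
  sends-𝟎 {record { a = a ; b = b ; c = c ; d = d }} =
    ≈-reflexive (solve (a ∷ b ∷ [])) , ≈-reflexive (solve (c ∷ d ∷ []))

  nonzero-to-e₁ : (c : Column) → c ≢ 𝟎 → ∃[ S ] Sends S ⟦ c ⟧ ⟦ e₁ ⟧
  nonzero-to-e₁ (u , v) c≢𝟎 with v Fin.≟ zero | u Fin.≟ zero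
  ... | no v≢0    | _         = let (w , wv≈1) = invertible v v≢0 in sends-to-e₁ {toℤ u} w wv≈1
  ... | yes refl  | yes refl  = ⊥-elim (c≢𝟎 refl)
  ... | yes refl  | no u≢0    =
    let (w , wu≈1) = invertible u u≢0
        (S , to-e₁) = sends-to-e₁ {toℤ u} {w * toℤ u} (+ 1)
                        (≈-trans (≈-reflexive (ℤ.*-identityˡ (w * toℤ u))) wu≈1)
    in S · lower w , sends-· {lower w} {S} (lower-sends {toℤ u} {w}) to-e₁

  column : ∀ {n} → Config p n → Fin n → Column
  column X i = proj₁ X i , proj₂ X i

  Act : ∀ {n} → SL2Z → Config p n → Config p n → Set
  Act S X Y = ∀ i → Sends S ⟦ column X i ⟧ ⟦ column Y i ⟧

  fromActs : ∀ {n S} {X Y : Config p n} → Acts S X Y → Act S X Y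
  fromActs {X = _ , _} {_ , _} h i = ⟨ proj₁ (h i) ⟩ , ⟨ proj₂ (h i) ⟩

  toActs : ∀ {n S} {X Y : Config p n} → Act S X Y → Acts S X Y
  toActs {X = _ , _} {_ , _} h i = get (proj₁ (h i)) , get (proj₂ (h i))

  infix 4 _∼_
  _∼_ : ∀ {n} → Config p n → Config p n → Set
  X ∼ Y = ∃[ S ] Act S X Y

  ∼-sym : ∀ {n} {X Y : Config p n} → X ∼ Y → Y ∼ X
  ∼-sym (S , act) = S ⁻¹ , λ i → sends-⁻¹ {S} (act i)

  ∼-trans : ∀ {n} {X Y Z : Config p n} → X ∼ Y → Y ∼ Z → X ∼ Z
  ∼-trans (S , act) (T , act′) = T · S , λ i → sends-· {S} {T} (act i) (act′ i)

  ≗⇒∼ : ∀ {n} {X Y : Config p n} → column X ≗ column Y → X ∼ Y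
  ≗⇒∼ {X = X} eq = upper (+ 0) , λ i →
    subst (λ c → Sends (upper (+ 0)) ⟦ column X i ⟧ ⟦ c ⟧) (eq i) identity
    where
    identity : ∀ {x y} → Sends (upper (+ 0)) (x , y) (x , y)
    identity {x} {y} =
      ≈-reflexive (solve (x ∷ y ∷ [])) , ≈-reflexive (+ 0 * x + + 1 * y ≡ y ∋ solve (x ∷ y ∷ []))

  apply : ∀ {n} → SL2Z → Config p n → Config p n
  apply {n} S X = (λ i → reduce (a * x i + b * y i)) , (λ i → reduce (c * x i + d * y i))
    where
    open SL2Z S
    x y : Fin n → ℤ
    x i = toℤ (proj₁ X i)
    y i = toℤ (proj₂ X i)

  apply-Act : ∀ {n} S (X : Config p n) → Act S X (apply S X)
  apply-Act S X i = ≈-sym (reduce-≈ _) , ≈-sym (reduce-≈ _)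

  zero-column-invariant : ∀ {n S} {X Y : Config p n} → Act S X Y → ∀ i → column X i ≡ 𝟎 → column Y i ≡ 𝟎
  zero-column-invariant {S = S} {X} {Y} act i eq =
    sends-functional {S} (subst (λ c → Sends S ⟦ c ⟧ ⟦ column Y i ⟧) eq (act i)) (sends-𝟎 {S})

  Sheared : ∀ {n} → ℤ → Config p n → Config p n → Set
  Sheared t X Y =
    ∀ i → (toℤ (proj₁ Y i) ≈ toℤ (proj₁ X i) + t * toℤ (proj₂ X i)) × (proj₂ Y i ≡ proj₂ X i)

  fixing-e₁⇒sheared : ∀ {n S} {X Y : Config p n} → Sends S ⟦ e₁ ⟧ ⟦ e₁ ⟧ → Act S X Y → Sheared (SL2Z.b S) X Y
  fixing-e₁⇒sheared {S = S} fixes act i =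
    let (u′≈u+bv , v′≈v) = fixes-e₁⇒shear {S} fixes (act i) in u′≈u+bv , toℤ-≈-injective v′≈v

  apply-upper-sheared : ∀ {n} t (Y : Config p n) → Sheared t Y (apply (upper t) Y)
  apply-upper-sheared t Y = fixing-e₁⇒sheared {S = upper t} {Y} (upper-fixes-e₁ {t}) (apply-Act (upper t) Y)

  sheared-column : ∀ {n t} {Y Z : Config p n} → Sheared t Y Z →
                   ∀ i → proj₂ Y i ≡ zero → column Z i ≡ column Y i
  sheared-column {t = t} {Y} sheared i v≡0 = cong₂ _,_
    (toℤ-≈-injective (≈-trans (proj₁ (sheared i)) (x+y≈x (≈-reflexive tv≡0))))
    (proj₂ (sheared i))
    where
    tv≡0 : t * toℤ (proj₂ Y i) ≡ + 0
    tv≡0 = trans (cong (λ v → t * toℤ v) v≡0) (ℤ.*-zeroʳ t)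

  letter : Column → Fin (p ℕ.* p)
  letter (u , v) = Fin.combine v u

  encode : ∀ {n} → Config p n → Word p n
  encode X i = letter (column X i)

  letter-injective : ∀ {c c′} → toℕ (letter c) ≡ toℕ (letter c′) → c ≡ c′
  letter-injective {u , v} {u′ , v′} eq =
    let (v≡v′ , u≡u′) = Fin.combine-injective v u v′ u′ (Fin.toℕ-injective eq) in cong₂ _,_ u≡u′ v≡v′

  toℕ-letter-v≡0 : ∀ u → toℕ (letter (u , zero)) ≡ toℕ u
  toℕ-letter-v≡0 u = trans (Fin.toℕ-combine {p} zero u) (cong (ℕ._+ toℕ u) (ℕ.*-zeroʳ p))

  toℕ-letter-u≡0 : ∀ v → toℕ (letter (zero , v)) ≡ toℕ v ℕ.* p
  toℕ-letter-u≡0 v = trans (Fin.toℕ-combine v zero) (trans (ℕ.+-identityʳ _) (ℕ.*-comm p (toℕ v)))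

  letter≡0⇔ : ∀ c → toℕ (letter c) ≡ 0 ⇔ c ≡ 𝟎
  letter≡0⇔ c = mk⇔ (λ eq → letter-injective (trans eq (sym (toℕ-letter-v≡0 zero))))
                    (λ { refl → toℕ-letter-v≡0 zero })

  letter≡1⇔ : ∀ c → toℕ (letter c) ≡ 1 ⇔ c ≡ e₁
  letter≡1⇔ c = mk⇔ (λ eq → letter-injective (trans eq (sym (toℕ-letter-v≡0 (suc zero)))))
                    (λ { refl → toℕ-letter-v≡0 (suc zero) })

  letter<p⇔ : ∀ c → toℕ (letter c) < p ⇔ proj₂ c ≡ zero
  letter<p⇔ (u , v) = mk⇔ (to v) λ { refl → subst (_< p) (sym (toℕ-letter-v≡0 u)) (Fin.toℕ<n u) }
    where
    to : ∀ v → toℕ (letter (u , v)) < p → v ≡ zero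
    to zero    _ = refl
    to (suc v) letter<p = ⊥-elim (ℕ.<⇒≱ letter<p (begin
      p                                   ≤⟨ ℕ.m≤m*n p (toℕ (suc v)) ⟩
      p ℕ.* toℕ (suc v)                   ≤⟨ ℕ.m≤m+n _ (toℕ u) ⟩
      p ℕ.* toℕ (suc v) ℕ.+ toℕ u         ≡⟨ Fin.toℕ-combine (suc v) u ⟨
      toℕ (letter (u , suc v))            ∎))
      where open ℕ.≤-Reasoning

  IsMultLetter⇔ : ∀ c → IsMultLetter p (toℕ (letter c)) ⇔ (proj₁ c ≡ zero × proj₂ c ≢ zero)
  IsMultLetter⇔ (u , v) = mk⇔ to (from v)
    where
    to : IsMultLetter p (toℕ (letter (u , v))) → u ≡ zero × v ≢ zero
    to (t , 1≤t , t<p , eq) with letter-injective {u , v} {zero , fromℕ< t<p}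
           (trans eq (trans (cong (ℕ._* p) (sym (Fin.toℕ-fromℕ< t<p))) (sym (toℕ-letter-u≡0 (fromℕ< t<p)))))
    ... | refl = refl , λ t≡0 → ℕ.<⇒≢ 1≤t (sym (trans (sym (Fin.toℕ-fromℕ< t<p)) (cong toℕ t≡0)))
    from : ∀ v → u ≡ zero × v ≢ zero → IsMultLetter p (toℕ (letter (u , v)))
    from zero    (_    , v≢0) = ⊥-elim (v≢0 refl)
    from (suc v) (refl , _)   = toℕ (suc v) , s≤s z≤n , Fin.toℕ<n (suc v) , toℕ-letter-u≡0 (suc v)

  record Canonical {n} (X : Config p n) : Set where
    field
      j k : ℕ
      1≤j : 1 ≤ j
      j<k : j < k
      j≤1+n : j ≤ ℕ.suc n
      zero-before-j : ∀ i → pos i < j → column X i ≡ 𝟎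
      e₁-at-j : ∀ i → pos i ≡ j → column X i ≡ e₁
      v-zero-between : ∀ i → j < pos i → pos i < k → proj₂ X i ≡ zero
      pivot-at-k : ∀ i → pos i ≡ k → proj₁ X i ≡ zero × proj₂ X i ≢ zero

    1≤k : 1 ≤ k
    1≤k = ℕ.<⇒≤ (ℕ.≤-<-trans 1≤j j<k)

    v-zero-before-k : ∀ i → pos i < k → proj₂ X i ≡ zero
    v-zero-before-k i pos<k with ℕ.<-cmp (pos i) j
    ... | tri< pos<j _ _ = cong proj₂ (zero-before-j i pos<j)
    ... | tri≈ _ pos≡j _ = cong proj₂ (e₁-at-j i pos≡j)
    ... | tri> _ _ j<pos = v-zero-between i j<pos pos<k

  open Canonical

  canonical⇒InW : ∀ {n} {X : Config p n} → Canonical X → InW p n (encode X)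
  canonical⇒InW cX = j cX , k cX , 1≤j cX , j<k cX , j≤1+n cX ,
    (λ i lt → from (letter≡0⇔ _) (zero-before-j cX i lt)) ,
    (λ i eq → from (letter≡1⇔ _) (e₁-at-j cX i eq)) ,
    (λ i lt₁ lt₂ → from (letter<p⇔ _) (v-zero-between cX i lt₁ lt₂)) ,
    (λ i eq → from (IsMultLetter⇔ _) (pivot-at-k cX i eq))
    where open Equivalence

  InW⇒canonical : ∀ {n} {X : Config p n} → InW p n (encode X) → Canonical X
  InW⇒canonical (j , k , 1≤j , j<k , j≤1+n , R1 , R2 , R3 , R4) = record
    { j = j ; k = k ; 1≤j = 1≤j ; j<k = j<k ; j≤1+n = j≤1+n
    ; zero-before-j = λ i lt → to (letter≡0⇔ _) (R1 i lt)
    ; e₁-at-j = λ i eq → to (letter≡1⇔ _) (R2 i eq)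
    ; v-zero-between = λ i lt₁ lt₂ → to (letter<p⇔ _) (R3 i lt₁ lt₂)
    ; pivot-at-k = λ i eq → to (IsMultLetter⇔ _) (R4 i eq)
    }
    where open Equivalence

  InW-resp : ∀ {n} {w w′ : Word p n} → w ≈W w′ → InW p n w → InW p n w′
  InW-resp eq (j , k , 1≤j , j<k , j≤1+n , R1 , R2 , R3 , R4) = j , k , 1≤j , j<k , j≤1+n ,
    (λ i lt → trans (cong toℕ (sym (eq i))) (R1 i lt)) ,
    (λ i lt → trans (cong toℕ (sym (eq i))) (R2 i lt)) ,
    (λ i lt₁ lt₂ → subst (_< p) (cong toℕ (eq i)) (R3 i lt₁ lt₂)) ,
    (λ i lt → subst (IsMultLetter p) (cong toℕ (eq i)) (R4 i lt))

  leading-≤ : ∀ {n} {X Y : Config p n} → X ∼ Y → (cX : Canonical X) (cY : Canonical Y) → j cX ≤ j cY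
  leading-≤ {n} {X} {Y} (S , act) cX cY with j cY ℕ.≤? n
  ... | yes jY≤n = least-≤ {P = λ i → column X i ≢ 𝟎}
    (λ i pos<j nonzero → nonzero (zero-before-j cX i pos<j))
    (λ i pos≡j zero →
      e₁≢𝟎 (trans (sym (e₁-at-j cY i pos≡j)) (zero-column-invariant {S = S} {X} {Y} act i zero)))
    (1≤j cY) jY≤n
    where
    e₁≢𝟎 : e₁ ≢ 𝟎
    e₁≢𝟎 ()
  ... | no jY≰n = ℕ.≤-trans (j≤1+n cX) (ℕ.≰⇒> jY≰n)

  leading-unique : ∀ {n} {X Y : Config p n} → X ∼ Y → (cX : Canonical X) (cY : Canonical Y) → j cX ≡ j cY
  leading-unique X∼Y cX cY = ℕ.≤-antisym (leading-≤ X∼Y cX cY) (leading-≤ (∼-sym X∼Y) cY cX)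

  pivot-≤ : ∀ {n} {X Y : Config p n} (cX : Canonical X) (cY : Canonical Y) →
            (∀ i → proj₂ X i ≡ proj₂ Y i) → k cY ≤ n → k cX ≤ k cY
  pivot-≤ {X = X} cX cY same-v kY≤n = least-≤ {P = λ i → proj₂ X i ≢ zero}
    (λ i pos<k nonzero → nonzero (v-zero-before-k cX i pos<k))
    (λ i pos≡k → subst (_≢ zero) (sym (same-v i)) (proj₂ (pivot-at-k cY i pos≡k)))
    (1≤k cY) kY≤n

  pivot-unique : ∀ {n} {X Y : Config p n} (cX : Canonical X) (cY : Canonical Y) →
                 (∀ i → proj₂ X i ≡ proj₂ Y i) → k cX ≤ n → k cX ≡ k cY
  pivot-unique {n} cX cY same-v kX≤n = ℕ.≤-antisym kX≤kY (pivot-≤ cY cX (sym ∘ same-v) kX≤n)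
    where
    kX≤kY : k cX ≤ k cY
    kX≤kY with k cY ℕ.≤? n
    ... | yes kY≤n = pivot-≤ cX cY same-v kY≤n
    ... | no kY≰n  = ℕ.<⇒≤ (ℕ.≤-<-trans kX≤n (ℕ.≰⇒> kY≰n))

  sheared-canonical-unique : ∀ {n t} {X Y : Config p n} → Canonical X → Canonical Y → Sheared t X Y →
                             column X ≗ column Y
  sheared-canonical-unique {n} {t} {X} {Y} cX cY sheared i =
    cong₂ _,_ (toℤ-≈-injective (≈-sym (≈-trans (proj₁ (sheared i)) (x+y≈x (tv≈0 i)))))
              (sym (proj₂ (sheared i)))
    where
    same-v : ∀ i → proj₂ X i ≡ proj₂ Y i
    same-v i = sym (proj₂ (sheared i))

    t≈0 : k cX ≤ n → t ≈ + 0
    t≈0 kX≤n with position (1≤k cX) kX≤n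
    ... | i , pos≡k with pivot-at-k cX i pos≡k | pivot-at-k cY i (trans pos≡k (pivot-unique cX cY same-v kX≤n))
    ...   | uX≡0 , v≢0 | uY≡0 , _ with invertible (proj₂ X i) v≢0
    ...     | w , wv≈1 = cancel-invertible w wv≈1 (begin
      t * v                       ≡⟨ ℤ.+-identityˡ (t * v) ⟨
      + 0 + t * v                 ≡⟨ cong (λ u → toℤ u + t * v) uX≡0 ⟨
      toℤ (proj₁ X i) + t * v     ≈⟨ ≈-sym (proj₁ (sheared i)) ⟩
      toℤ (proj₁ Y i)             ≡⟨ cong toℤ uY≡0 ⟩
      + 0                         ∎)
      where
      open ≈-Reasoning
      v : ℤ
      v = toℤ (proj₂ X i)

    tv≈0 : ∀ i → t * toℤ (proj₂ X i) ≈ + 0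
    tv≈0 i with proj₂ X i Fin.≟ zero
    ... | yes v≡0 = ≈-reflexive (trans (cong (λ v → t * toℤ v) v≡0) (ℤ.*-zeroʳ t))
    ... | no v≢0  = ≈-trans (*-cong (t≈0 kX≤n) ≈-refl) (≈-reflexive (ℤ.*-zeroˡ (toℤ (proj₂ X i))))
      where
      kX≤n : k cX ≤ n
      kX≤n = ℕ.≤-trans (ℕ.≮⇒≥ λ pos<k → v≢0 (v-zero-before-k cX i pos<k)) (Fin.toℕ<n i)

  canonical-unique : ∀ {n} {X Y : Config p n} → Canonical X → Canonical Y → X ∼ Y → column X ≗ column Y
  canonical-unique {n} {X} {Y} cX cY X∼Y@(S , act) with j cX ℕ.≤? n
  ... | yes jX≤n = sheared-canonical-unique {t = SL2Z.b S} cX cY (fixing-e₁⇒sheared {S = S} {X} {Y} fixes-e₁ act)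
    where
    fixes-e₁ : Sends S ⟦ e₁ ⟧ ⟦ e₁ ⟧
    fixes-e₁ with position (1≤j cX) jX≤n
    ... | i , pos≡j = subst₂ (λ c c′ → Sends S ⟦ c ⟧ ⟦ c′ ⟧)
                        (e₁-at-j cX i pos≡j) (e₁-at-j cY i (trans pos≡j (leading-unique X∼Y cX cY))) (act i)
  ... | no jX≰n = λ i → trans (all-zero i) (sym (zero-column-invariant {S = S} {X} {Y} act i (all-zero i)))
    where
    all-zero : ∀ i → column X i ≡ 𝟎
    all-zero i = zero-before-j cX i (ℕ.≤-<-trans (Fin.toℕ<n i) (ℕ.≰⇒> jX≰n))

  record Leading {n} (Y : Config p n) : Set where
    field
      j : ℕ
      1≤j : 1 ≤ j
      j≤n : j ≤ n
      zero-before-j : ∀ i → pos i < j → column Y i ≡ 𝟎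
      e₁-at-j : ∀ i → pos i ≡ j → column Y i ≡ e₁

  leading-form : ∀ {n} (X : Config p n) (f : First (λ i → column X i ≢ 𝟎)) → First.index f ≤ n →
                 ∃[ Y ] X ∼ Y × Leading Y
  leading-form X f j≤n with position (First.1≤index f) j≤n
  ... | i₀ , pos≡j₀ with nonzero-to-e₁ (column X i₀) (First.at f i₀ pos≡j₀)
  ...   | S , to-e₁ = apply S X , (S , apply-Act S X) , record
    { j = index ; 1≤j = 1≤index ; j≤n = j≤n
    ; zero-before-j = λ i pos<j → zero-column-invariant {S = S} {X} {apply S X} (apply-Act S X) i
                                    (decidable-stable (column X i ≟ᶜ 𝟎) (before i pos<j))
    ; e₁-at-j = λ i pos≡j → sends-functional {S} (apply-Act S X i)
                  (subst (λ i → Sends S ⟦ column X i ⟧ ⟦ e₁ ⟧) (pos-injective (trans pos≡j₀ (sym pos≡j))) to-e₁)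
    }
    where open First f

  pivot-killing-shear : ∀ {n} (Y : Config p n) k → 1 ≤ k → (∀ i → pos i ≡ k → proj₂ Y i ≢ zero) →
                        ∃[ t ] (∀ i → pos i ≡ k → toℤ (proj₁ Y i) + t * toℤ (proj₂ Y i) ≈ + 0)
  pivot-killing-shear {n} Y k 1≤k pivot with k ℕ.≤? n
  ... | no k≰n = + 0 , λ i pos≡k → ⊥-elim (k≰n (subst (_≤ n) pos≡k (Fin.toℕ<n i)))
  ... | yes k≤n with position 1≤k k≤n
  ...   | i₁ , pos≡k with invertible (proj₂ Y i₁) (pivot i₁ pos≡k)
  ...     | w , wv≈1 = - (toℤ (proj₁ Y i₁) * w) , λ i pos≡k′ →
    subst (λ i → toℤ (proj₁ Y i) + - (toℤ (proj₁ Y i₁) * w) * toℤ (proj₂ Y i) ≈ + 0)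
          (pos-injective (trans pos≡k (sym pos≡k′))) (shear-kills {toℤ (proj₁ Y i₁)} w wv≈1)

  leading⇒canonical : ∀ {n} {Y : Config p n} → Leading Y → First (λ i → proj₂ Y i ≢ zero) →
                      ∃[ Z ] Y ∼ Z × Canonical Z
  leading⇒canonical {n} {Y} lead f with pivot-killing-shear Y (First.index f) (First.1≤index f) (First.at f)
  ... | t , kills = Z , (upper t , apply-Act (upper t) Y) , record
    { j = L.j ; k = index ; 1≤j = L.1≤j ; j<k = j<index ; j≤1+n = ℕ.m≤n⇒m≤1+n L.j≤n
    ; zero-before-j = λ i pos<j → trans (unchanged i (v≡0 (ℕ.<⇒≤ pos<j))) (L.zero-before-j i pos<j)
    ; e₁-at-j = λ i pos≡j → trans (unchanged i (v≡0 (ℕ.≤-reflexive pos≡j))) (L.e₁-at-j i pos≡j)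
    ; v-zero-between = λ i _ pos<k →
        trans (proj₂ (sheared i)) (decidable-stable (proj₂ Y i Fin.≟ zero) (before i pos<k))
    ; pivot-at-k = λ i pos≡k →
        toℤ-≈-injective (≈-trans (proj₁ (sheared i)) (kills i pos≡k)) ,
        subst (_≢ zero) (sym (proj₂ (sheared i))) (at i pos≡k)
    }
    where
    module L = Leading lead
    open First f

    Z : Config p n
    Z = apply (upper t) Y

    sheared : Sheared t Y Z
    sheared = apply-upper-sheared t Y

    unchanged : ∀ i → proj₂ Y i ≡ zero → column Z i ≡ column Y i
    unchanged = sheared-column {t = t} {Y} {Z} sheared

    v≡0 : ∀ {i} → pos i ≤ L.j → proj₂ Y i ≡ zero
    v≡0 {i} pos≤j with ℕ.m≤n⇒m<n∨m≡n pos≤j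
    ... | inj₁ pos<j = cong proj₂ (L.zero-before-j i pos<j)
    ... | inj₂ pos≡j = cong proj₂ (L.e₁-at-j i pos≡j)

    j<index : L.j < index
    j<index = ℕ.≰⇒> λ k≤j →
      let (i , pos≡k) = position 1≤index (ℕ.≤-trans k≤j L.j≤n)
      in at i pos≡k (v≡0 (subst (_≤ L.j) (sym pos≡k) k≤j))

  zero-canonical : ∀ {n} {X : Config p n} → (∀ i → column X i ≡ 𝟎) → Canonical X
  zero-canonical {n} all-zero = record
    { j = ℕ.suc n ; k = ℕ.suc (ℕ.suc n) ; 1≤j = s≤s z≤n ; j<k = ℕ.≤-refl ; j≤1+n = ℕ.≤-refl
    ; zero-before-j = λ i _ → all-zero i
    ; e₁-at-j = λ i pos≡j → ⊥-elim (beyond i ℕ.≤-refl pos≡j)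
    ; v-zero-between = λ i 1+n<pos _ → ⊥-elim (beyond i (ℕ.<⇒≤ 1+n<pos) refl)
    ; pivot-at-k = λ i pos≡k → ⊥-elim (beyond i (ℕ.m≤n⇒m≤1+n ℕ.≤-refl) pos≡k)
    }
    where
    beyond : ∀ {k} (i : Fin n) → n < k → pos i ≢ k
    beyond i n<k refl = ℕ.<⇒≱ n<k (Fin.toℕ<n i)

  canonical-form : ∀ {n} (X : Config p n) → ∃[ Z ] X ∼ Z × Canonical Z
  canonical-form {n} X with first (λ i → ¬? (column X i ≟ᶜ 𝟎))
  ... | f with First.index f ℕ.≤? n
  ...   | yes j≤n =
    let (Y , X∼Y , lead) = leading-form X f j≤n
        (Z , Y∼Z , cZ) = leading⇒canonical lead (first (λ i → ¬? (proj₂ Y i Fin.≟ zero)))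
    in Z , ∼-trans X∼Y Y∼Z , cZ
  ...   | no j≰n = X , ≗⇒∼ (λ _ → refl) , zero-canonical λ i →
    decidable-stable (column X i ≟ᶜ 𝟎) (First.before f i (ℕ.≤-<-trans (Fin.toℕ<n i) (ℕ.≰⇒> j≰n)))

  decode : ∀ {n} → Word p n → Config p n
  decode w = (λ i → proj₂ (Fin.remQuot {p} p (w i))) , (λ i → proj₁ (Fin.remQuot {p} p (w i)))

  encode-decode : ∀ {n} (w : Word p n) → encode (decode w) ≈W w
  encode-decode w i = Fin.combine-remQuot {p} p (w i)

  orbit-bijection : ∀ n → OrbitBijection p n
  orbit-bijection n = encode ∘ normal , (λ X → canonical⇒InW (normal-canonical X)) ,
                      same-orbit⇒same-word , same-word⇒same-orbit , onto
    where
    normal : Config p n → Config p n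
    normal X = proj₁ (canonical-form X)
    ∼normal : ∀ X → X ∼ normal X
    ∼normal X = proj₁ (proj₂ (canonical-form X))
    normal-canonical : ∀ X → Canonical (normal X)
    normal-canonical X = proj₂ (proj₂ (canonical-form X))

    same-orbit⇒same-word : ∀ X Y → SameOrbit X Y → encode (normal X) ≈W encode (normal Y)
    same-orbit⇒same-word X Y (S , acts) i = cong letter (canonical-unique (normal-canonical X) (normal-canonical Y)
      (∼-trans (∼-sym (∼normal X)) (∼-trans (S , fromActs {S = S} {X} {Y} acts) (∼normal Y))) i)

    same-word⇒same-orbit : ∀ X Y → encode (normal X) ≈W encode (normal Y) → SameOrbit X Y
    same-word⇒same-orbit X Y eq =
      let same-normal = ≗⇒∼ (letter-injective ∘ cong toℕ ∘ eq)
          (S , act) = ∼-trans (∼normal X) (∼-trans same-normal (∼-sym (∼normal Y)))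
      in S , toActs {S = S} {X} {Y} act

    onto : ∀ w → InW p n w → ∃[ X ] encode (normal X) ≈W w
    onto w w∈W = X , λ i → trans (cong letter (canonical-unique (normal-canonical X) cX (∼-sym (∼normal X)) i))
                                 (encode-decode w i)
      where
      X : Config p n
      X = decode w
      cX : Canonical X
      cX = InW⇒canonical (InW-resp (sym ∘ encode-decode w) w∈W)

theorem1 : (p n : ℕ) → Prime p → 1 ≤ n → OrbitBijection p n
theorem1 0 _ isPrime _ with prime⇒nonTrivial isPrime
... | ()
theorem1 1 _ isPrime _ with prime⇒nonTrivial isPrime
... | ()
theorem1 (ℕ.suc (ℕ.suc q)) n isPrime _ = Orbits.orbit-bijection q isPrime n
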